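{- The forgetful functor $U:\mathsf{PE}_{\mathbf{Set}}\to\mathbf{Span}_{\mathbf{Set}}$, sending a polynomial $I\leftarrow D\to A\to I$ to the set $I$ and a simulation to its underlying span, has a left adjoint and a right adjoint.
   Context: $\mathbf{Span}_{\mathbf{Set}}$ is the category whose objects are sets and whose morphisms $I\to J$ are isomorphism classes of spans $I\leftarrow R\to J$ of functions, composed by pullback. A polynomial over a set $I$ is a diagram of functions $I\xleftarrow{n}D\xrightarrow{d}A\xrightarrow{a}I$. A simulation from $P_1=(I_1\xleftarrow{n_1}D_1\xrightarrow{d_1}A_1\xrightarrow{a_1}I_1)$ to $P_2=(I_2\xleftarrow{n_2}D_2\xrightarrow{d_2}A_2\xrightarrow{a_2}I_2)$ consists of: a span $I_1\xleftarrow{r_1}R\xrightarrow{r_2}I_2$; writing $R\cdot A_1$ for the pullback of $a_1$ along $r_1$ (projections $x$ to $R$, $y$ to $A_1$), a function $\alpha:R\cdot A_1\to A_2$ with $a_2\alpha=r_2x$; writing $R\cdot D_2$ for the pullback of $d_2$ along $\alpha$ (projections $p$, $q$ to $R\cdot A_1$, $D_2$), functions $\beta:R\cdot D_2\to D_1$, $\gamma:R\cdot D_2\to R$ with $d_1\beta=yp$, $n_1\beta=r_1\gamma$, $n_2q=r_2\gamma$. Simulations are identified when there is an isomorphism of spans transporting $\alpha,\beta,\gamma$. Composition: span $R\times_{I_2}R'$, $\alpha''(r,r',a_1)=\alpha'(r',\alpha(r,a_1))$, and for $d_3$ over $\alpha''$, with $d_2=\beta'(r',\alpha(r,a_1),d_3)$,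 $\beta''=\beta(r,a_1,d_2)$, $\gamma''=(\gamma(r,a_1,d_2),\gamma'(r',\alpha(r,a_1),d_3))$; identities have span $I\xleftarrow{1}I\xrightarrow{1}I$, $\alpha=1$, $\beta=1$, $\gamma=n$. $\mathsf{PE}_{\mathbf{Set}}$ has polynomials as objects and equivalence classes of simulations as morphisms. -}

module Defs where

open import Level using (Level; _⊔_) renaming (suc to lsuc; zero to lzero)
open import Data.Product using (Σ; _×_; _,_; proj₁; proj₂)
open import Function using (id; _∘_)
open import Relation.Binary.PropositionalEquality
  using (_≡_; refl; sym; trans; cong)

record Cat (o h e : Level) : Set (lsuc (o ⊔ h ⊔ e)) where
  infixr 9 _∘C_
  field
    Obj  : Set o
    Hom  : Obj → Obj → Set h
    _≈_  : ∀ {X Y} → Hom X Y → Hom X Y → Set e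
    idC  : ∀ {X} → Hom X X
    _∘C_ : ∀ {X Y Z} → Hom Y Z → Hom X Y → Hom X Z

record Functor {o h e o' h' e'} (C : Cat o h e) (D : Cat o' h' e')
       : Set (o ⊔ h ⊔ e ⊔ o' ⊔ h' ⊔ e') where
  private
    module C = Cat C
    module D = Cat D
  field
    F₀     : C.Obj → D.Obj
    F₁     : ∀ {X Y} → C.Hom X Y → D.Hom (F₀ X) (F₀ Y)
    F-resp : ∀ {X Y} {f g : C.Hom X Y} → f C.≈ g → F₁ f D.≈ F₁ g
    F-id   : ∀ {X} → F₁ (C.idC {X}) D.≈ D.idC
    F-∘    : ∀ {X Y Z} (g : C.Hom Y Z) (f : C.Hom X Y) →
             F₁ (g C.∘C f) D.≈ (F₁ g D.∘C F₁ f)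

record Adjunction {o h e o' h' e'} {C : Cat o h e} {D : Cat o' h' e'}
       (L : Functor C D) (R : Functor D C)
       : Set (o ⊔ h ⊔ e ⊔ o' ⊔ h' ⊔ e') where
  private
    module C = Cat C
    module D = Cat D
    module L = Functor L
    module R = Functor R
  field
    η   : ∀ X → C.Hom X (R.F₀ (L.F₀ X))
    ε   : ∀ Y → D.Hom (L.F₀ (R.F₀ Y)) Y
    η-natural : ∀ {X X'} (f : C.Hom X X') →
                (η X' C.∘C f) C.≈ (R.F₁ (L.F₁ f) C.∘C η X)
    ε-natural : ∀ {Y Y'} (g : D.Hom Y Y') →
                (ε Y' D.∘C L.F₁ (R.F₁ g)) D.≈ (g D.∘C ε Y)
    triangleL : ∀ X → (ε (L.F₀ X) D.∘C L.F₁ (η X)) D.≈ D.idC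
    triangleR : ∀ Y → (R.F₁ (ε Y) C.∘C η (R.F₀ Y)) C.≈ C.idC

record Span (I J : Set) : Set₁ where
  constructor span
  field
    apex : Set
    lft  : apex → I
    rgt  : apex → J
open Span public

record SpanIso {I J : Set} (S T : Span I J) : Set where
  field
    to      : apex S → apex T
    from    : apex T → apex S
    from∘to : ∀ x → from (to x) ≡ x
    to∘from : ∀ y → to (from y) ≡ y
    lft-to  : ∀ x → lft T (to x) ≡ lft S x
    rgt-to  : ∀ x → rgt T (to x) ≡ rgt S x
open SpanIso public

Pb : {A B C : Set} → (A → C) → (B → C) → Set
Pb {A} {B} f g = Σ (A × B) (λ ab → f (proj₁ ab) ≡ g (proj₂ ab))

idSpan : (I : Set) → Span I I
idSpan I = span I id id

_⊙_ : {I J K : Set} → Span J K → Span I J → Span I K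
T ⊙ S = span (Pb (rgt S) (lft T))
             (λ w → lft S (proj₁ (proj₁ w)))
             (λ w → rgt T (proj₂ (proj₁ w)))

SpanSet : Cat (lsuc lzero) (lsuc lzero) lzero
SpanSet = record
  { Obj  = Set
  ; Hom  = Span
  ; _≈_  = SpanIso
  ; idC  = λ {I} → idSpan I
  ; _∘C_ = _⊙_
  }

record Poly : Set₁ where
  constructor poly
  field
    I D A : Set
    n : D → I
    d : D → A
    a : A → I

record Sim (P₁ P₂ : Poly) : Set₁ where
  private
    module P₁ = Poly P₁
    module P₂ = Poly P₂
  field
    rel : Span P₁.I P₂.I
  RA : Set
  RA = Pb (lft rel) P₁.a
  xR : RA → apex rel
  xR z = proj₁ (proj₁ z)
  yA : RA → P₁.A
  yA z = proj₂ (proj₁ z)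
  field
    α    : RA → P₂.A
    α-eq : ∀ z → P₂.a (α z) ≡ rgt rel (xR z)
  RD : Set
  RD = Pb α P₂.d
  pRD : RD → RA
  pRD w = proj₁ (proj₁ w)
  qRD : RD → P₂.D
  qRD w = proj₂ (proj₁ w)
  field
    β    : RD → P₁.D
    γ    : RD → apex rel
    β-d  : ∀ w → P₁.d (β w) ≡ yA (pRD w)
    β-n  : ∀ w → P₁.n (β w) ≡ lft rel (γ w)
    γ-n  : ∀ w → P₂.n (qRD w) ≡ rgt rel (γ w)

-- Equivalence of simulations: an isomorphism of spans transporting α, β, γ.
-- (Proofs of equations in pullback elements are quantified over freely;
-- with K they are unique anyway.)
record SimEq {P₁ P₂ : Poly} (S T : Sim P₁ P₂) : Set where
  private
    module S = Sim S
    module T = Sim T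
  field
    iso : SpanIso S.rel T.rel
  φ = to iso
  field
    α-tr : ∀ ρ x p p' → T.α ((φ ρ , x) , p') ≡ S.α ((ρ , x) , p)
    β-tr : ∀ ρ x p p' e q q' →
           T.β ((((φ ρ , x) , p') , e) , q') ≡ S.β ((((ρ , x) , p) , e) , q)
    γ-tr : ∀ ρ x p p' e q q' →
           T.γ ((((φ ρ , x) , p') , e) , q') ≡ φ (S.γ ((((ρ , x) , p) , e) , q))

idSim : (P : Poly) → Sim P P
idSim P = record
  { rel  = idSpan (Poly.I P)
  ; α    = λ z → proj₂ (proj₁ z)
  ; α-eq = λ z → sym (proj₂ z)
  ; β    = λ w → proj₂ (proj₁ w)
  ; γ    = λ w → Poly.n P (proj₂ (proj₁ w))
  ; β-d  = λ w → sym (proj₂ w)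
  ; β-n  = λ w → refl
  ; γ-n  = λ w → refl
  }

_⊚_ : {P₁ P₂ P₃ : Poly} → Sim P₂ P₃ → Sim P₁ P₂ → Sim P₁ P₃
_⊚_ {P₁} {P₂} {P₃} S' S = record
  { rel  = Sim.rel S' ⊙ Sim.rel S
  ; α    = α''
  ; α-eq = λ z → S'.α-eq (z' z)
  ; β    = λ w → S.β (w₁ w)
  ; γ    = γ''
  ; β-d  = λ w → S.β-d (w₁ w)
  ; β-n  = λ w → S.β-n (w₁ w)
  ; γ-n  = λ w → S'.γ-n (w' w)
  }
  where
  module S  = Sim S
  module S' = Sim S'
  RA'' : Set
  RA'' = Pb (λ (v : apex (Sim.rel S' ⊙ Sim.rel S)) → lft S.rel (proj₁ (proj₁ v))) (Poly.a P₁)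
  zS : RA'' → S.RA
  zS ((((ρ , ρ') , h) , x) , p) = (ρ , x) , p
  z' : RA'' → S'.RA
  z' u@((((ρ , ρ') , h) , x) , p) =
    (ρ' , S.α (zS u)) , trans (sym h) (sym (S.α-eq (zS u)))
  α'' : RA'' → Poly.A P₃
  α'' u = S'.α (z' u)
  RD'' : Set
  RD'' = Pb α'' (Poly.d P₃)
  w' : RD'' → S'.RD
  w' ((u , e₃) , q) = (z' u , e₃) , q
  w₁ : RD'' → S.RD
  w₁ v@((u , e₃) , q) = (zS u , S'.β (w' v)) , sym (S'.β-d (w' v))
  γ'' : RD'' → apex (Sim.rel S' ⊙ Sim.rel S)
  γ'' v = (S.γ (w₁ v) , S'.γ (w' v)) ,
          trans (sym (S.γ-n (w₁ v))) (S'.β-n (w' v))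

PESet : Cat (lsuc lzero) (lsuc lzero) lzero
PESet = record
  { Obj  = Poly
  ; Hom  = Sim
  ; _≈_  = SimEq
  ; idC  = λ {P} → idSim P
  ; _∘C_ = _⊚_
  }

reflIso : {I J : Set} (S : Span I J) → SpanIso S S
reflIso S = record
  { to = id ; from = id ; from∘to = λ _ → refl ; to∘from = λ _ → refl
  ; lft-to = λ _ → refl ; rgt-to = λ _ → refl }

U : Functor PESet SpanSet
U = record
  { F₀     = Poly.I
  ; F₁     = Sim.rel
  ; F-resp = SimEq.iso
  ; F-id   = λ {P} → reflIso (idSpan (Poly.I P))
  ; F-∘    = λ g f → reflIso (Sim.rel g ⊙ Sim.rel f)
  }

module Submission where

-- Left adjoint:  I ↦ (I ← ∅ → ∅ → I), the polynomial with no shapes.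
-- Right adjoint: I ↦ (I ← ∅ → I → I), one shape per index, no directions.
--
-- Both rest on two degeneracy principles, proved first in general:
--   * a simulation out of a polynomial with no shapes is nothing but a span,
--     and two such simulations are equivalent as soon as their spans are
--     isomorphic (the data α, β, γ all live over the empty set);
--   * a simulation into a polynomial with no directions is a span together
--     with a shape map α, and equivalence only has to transport α.
-- The functors L and R keep a span as the underlying relation, the
-- units and counits have identity spans, and every naturality and
-- triangle law then reduces to one of two unit-law isomorphisms of spans,
-- id ⊙ f ≅ f ⊙ id and id ⊙ id ≅ id, plus (for R) transport of α.

open import Defs
open import Data.Product using (Σ; _×_; _,_; proj₁; proj₂)
open import Data.Empty using (⊥; ⊥-elim)
open import Function using (id)
open import Relation.Nullary using (¬_)
open import Relation.Binary.PropositionalEquality using (_≡_; refl; sym)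

unitSwapIso : {I J : Set} (f : Span I J) → SpanIso (idSpan J ⊙ f) (f ⊙ idSpan I)
unitSwapIso f = record
  { to      = λ { ((r , j) , _) → (lft f r , r) , refl }
  ; from    = λ { ((i , r) , _) → (r , rgt f r) , refl }
  ; from∘to = λ { ((r , j) , refl) → refl }
  ; to∘from = λ { ((i , r) , refl) → refl }
  ; lft-to  = λ _ → refl
  ; rgt-to  = λ { ((r , j) , refl) → refl } }

idIdempotentIso : (I : Set) → SpanIso (idSpan I ⊙ idSpan I) (idSpan I)
idIdempotentIso I = record
  { to      = λ { ((i , j) , _) → i }
  ; from    = λ i → (i , i) , refl
  ; from∘to = λ { ((i , j) , refl) → refl }
  ; to∘from = λ _ → refl
  ; lft-to  = λ _ → refl
  ; rgt-to  = λ { ((i , j) , refl) → refl } }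

module _ {P₁ P₂ : Poly} (noShape : ¬ Poly.A P₁) where

  simFromNoShapes : Span (Poly.I P₁) (Poly.I P₂) → Sim P₁ P₂
  simFromNoShapes S = record
    { rel  = S
    ; α    = α
    ; α-eq = λ z → ⊥-elim (noShape (proj₂ (proj₁ z)))
    ; β    = λ w → ⊥-elim (overNoShape w)
    ; γ    = λ w → ⊥-elim (overNoShape w)
    ; β-d  = λ w → ⊥-elim (overNoShape w)
    ; β-n  = λ w → ⊥-elim (overNoShape w)
    ; γ-n  = λ w → ⊥-elim (overNoShape w) }
    where
    α : Pb (lft S) (Poly.a P₁) → Poly.A P₂
    α z = ⊥-elim (noShape (proj₂ (proj₁ z)))
    -- an element of R·D₂ lies over a shape of P₁, so there is none
    overNoShape : Pb α (Poly.d P₂) → ⊥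
    overNoShape w = noShape (proj₂ (proj₁ (proj₁ (proj₁ w))))

  simEqFromNoShapes : {S T : Sim P₁ P₂} →
                      SpanIso (Sim.rel S) (Sim.rel T) → SimEq S T
  simEqFromNoShapes i = record
    { iso  = i
    ; α-tr = λ _ x → ⊥-elim (noShape x)
    ; β-tr = λ _ x → ⊥-elim (noShape x)
    ; γ-tr = λ _ x → ⊥-elim (noShape x) }

module _ {P₁ P₂ : Poly} (noDirection : ¬ Poly.D P₂) where

  simIntoNoDirections : (S : Span (Poly.I P₁) (Poly.I P₂))
                        (α : Pb (lft S) (Poly.a P₁) → Poly.A P₂) →
                        (∀ z → Poly.a P₂ (α z) ≡ rgt S (proj₁ (proj₁ z))) →
                        Sim P₁ P₂
  simIntoNoDirections S α α-eq = record
    { rel  = S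
    ; α    = α
    ; α-eq = α-eq
    ; β    = λ w → ⊥-elim (noDirection (proj₂ (proj₁ w)))
    ; γ    = λ w → ⊥-elim (noDirection (proj₂ (proj₁ w)))
    ; β-d  = λ w → ⊥-elim (noDirection (proj₂ (proj₁ w)))
    ; β-n  = λ w → ⊥-elim (noDirection (proj₂ (proj₁ w)))
    ; γ-n  = λ w → ⊥-elim (noDirection (proj₂ (proj₁ w))) }

  simEqIntoNoDirections :
    {S T : Sim P₁ P₂} (i : SpanIso (Sim.rel S) (Sim.rel T)) →
    (∀ ρ x p p' → Sim.α T ((to i ρ , x) , p') ≡ Sim.α S ((ρ , x) , p)) →
    SimEq S T
  simEqIntoNoDirections i α-tr = record
    { iso  = i
    ; α-tr = α-tr
    ; β-tr = λ _ _ _ _ e → ⊥-elim (noDirection e)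
    ; γ-tr = λ _ _ _ _ e → ⊥-elim (noDirection e) }

noShapesPoly : Set → Poly
noShapesPoly I = poly I ⊥ ⊥ ⊥-elim ⊥-elim ⊥-elim

L : Functor SpanSet PESet
L = record
  { F₀     = noShapesPoly
  ; F₁     = simFromNoShapes id
  ; F-resp = simEqFromNoShapes id
  ; F-id   = λ {I} → simEqFromNoShapes id (reflIso (idSpan I))
  ; F-∘    = λ g f → simEqFromNoShapes id (reflIso (g ⊙ f)) }

adjL : Adjunction L U
adjL = record
  { η         = idSpan
  ; ε         = λ P → simFromNoShapes id (idSpan (Poly.I P))
  ; η-natural = unitSwapIso
  ; ε-natural = λ g → simEqFromNoShapes id (unitSwapIso (Sim.rel g))
  ; triangleL = λ I → simEqFromNoShapes id (idIdempotentIso I)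
  ; triangleR = λ P → idIdempotentIso (Poly.I P) }

indexShapesPoly : Set → Poly
indexShapesPoly J = poly J ⊥ J ⊥-elim ⊥-elim id

R : Functor SpanSet PESet
R = record
  { F₀     = indexShapesPoly
  ; F₁     = λ S → simIntoNoDirections id S (λ z → rgt S (proj₁ (proj₁ z))) (λ _ → refl)
  ; F-resp = λ i → simEqIntoNoDirections id i (λ ρ _ _ _ → rgt-to i ρ)
  ; F-id   = λ {I} → simEqIntoNoDirections id (reflIso (idSpan I)) (λ _ _ _ p' → sym p')
  ; F-∘    = λ g f → simEqIntoNoDirections id (reflIso (g ⊙ f)) (λ _ _ _ _ → refl) }

unitR : (P : Poly) → Sim P (indexShapesPoly (Poly.I P))
unitR P = simIntoNoDirections id (idSpan (Poly.I P)) (λ z → proj₁ (proj₁ z)) (λ _ → refl)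

adjR : Adjunction U R
adjR = record
  { η         = unitR
  ; ε         = idSpan
  ; η-natural = λ f → simEqIntoNoDirections id (unitSwapIso (Sim.rel f)) (unitSwapShapes {f = f})
  ; ε-natural = unitSwapIso
  ; triangleL = λ P → idIdempotentIso (Poly.I P)
  ; triangleR = λ J → simEqIntoNoDirections id (idIdempotentIso J) idIdempotentShapes }
  where
  -- both sides of η-naturality send a shape to the right index of its relation
  unitSwapShapes : ∀ {P Q} {f : Sim P Q} ρ x p p' →
    Sim.α (Functor.F₁ R (Sim.rel f) ⊚ unitR P) ((to (unitSwapIso (Sim.rel f)) ρ , x) , p')
      ≡ Sim.α (unitR Q ⊚ f) ((ρ , x) , p)
  unitSwapShapes ((r , j) , refl) x p p' = refl
  -- in the triangle, the shape is the index it sits over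
  idIdempotentShapes : ∀ {J} ρ x p p' →
    Sim.α (idSim (indexShapesPoly J)) ((to (idIdempotentIso J) ρ , x) , p')
      ≡ Sim.α (Functor.F₁ R (idSpan J) ⊚ unitR (indexShapesPoly J)) ((ρ , x) , p)
  idIdempotentShapes ((i , j) , refl) x p p' = sym p'

lemma3p2 : Σ (Functor SpanSet PESet) (λ L → Adjunction L U)
         × Σ (Functor SpanSet PESet) (λ R → Adjunction U R)
lemma3p2 = (L , adjL) , (R , adjR)
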